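{- Let $t\geq 2$ and $k$ be integers. (i) If $k=2t+r$ with $0\leq r\leq 2t-3$, then $A_{k,t}$ has an isolation set of size $2r+3=2k-4t+3$. (ii) If $k\geq 4t-3$, then $A_{k,t}$ has an isolation set of size $k$.
   Context: $[k]=\{1,\dots,k\}$ and $A_{k,t}$ is the Boolean matrix with rows and columns indexed by all $t$-subsets of $[k]$, with entry $1$ at $(x,y)$ iff $x\cap y\neq\emptyset$. An isolation set of a Boolean matrix $B$ is a set $F$ of entries of $B$ all equal to $1$, such that no two entries of $F$ lie in the same row or column, and no two entries of $F$ lie in a common $2\times 2$ all-ones submatrix of $B$ (i.e., for entries $(i,j),(i',j')\in F$ distinct, $B[i][j']=0$ or $B[i'][j]=0$). -}

module Defs where

open import Data.Nat using (ℕ)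
open import Data.Fin using (Fin)
open import Data.Fin.Subset using (Subset; ∣_∣; _∩_; Nonempty)
open import Data.Product using (Σ; _×_; _,_; proj₁; proj₂)
open import Data.Sum using (_⊎_)
open import Relation.Binary.PropositionalEquality using (_≡_)
open import Relation.Nullary using (¬_)

TSub : ℕ → ℕ → Set
TSub k t = Σ (Subset k) (λ x → ∣ x ∣ ≡ t)

-- Entry (x,y) of A_{k,t} equals 1 iff x ∩ y ≠ ∅
A1 : ∀ {k t} → TSub k t → TSub k t → Set
A1 x y = Nonempty (proj₁ x ∩ proj₁ y)

Entry : ℕ → ℕ → Set
Entry k t = TSub k t × TSub k t

row col : ∀ {k t} → Entry k t → Subset k
row e = proj₁ (proj₁ e)
col e = proj₁ (proj₂ e)

-- Distinct indices give entries in
-- distinct rows and distinct columns (hence the entries are distinct,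
-- so |F| = s), every entry is 1, and no two lie in a common 2x2
-- all-ones submatrix.
IsIsolationSet : ∀ {k t s} → (Fin s → Entry k t) → Set
IsIsolationSet {k} {t} {s} F =
  ((i : Fin s) → A1 (proj₁ (F i)) (proj₂ (F i)))
  × ((i j : Fin s) → ¬ (i ≡ j) →
       (¬ (row (F i) ≡ row (F j)))
       × (¬ (col (F i) ≡ col (F j)))
       × (¬ A1 (proj₁ (F i)) (proj₂ (F j)) ⊎ ¬ A1 (proj₁ (F j)) (proj₂ (F i))))

HasIsolationSetOfSize : ℕ → ℕ → ℕ → Set
HasIsolationSetOfSize k t s = Σ (Fin s → Entry k t) IsIsolationSet

-- Place m of the k points on the cycle ℤ/m.  The i-th entry has as row an arc of
-- a + 1 consecutive residues starting at i and as column an arc of b + 1 residues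
-- ending at i, both padded to t points by private blocks outside the cycle.  If row i
-- meets column j then j − i (mod m) is at most a + b, so row i meets column j and row
-- j meets column i only if i = j or m ≤ 2(a + b).  Hence 2(a + b) < m gives an
-- isolation set of size m as soon as the m + 2t − a − b − 2 points used fit into [k]:
-- for (ii) take m = k and a = b = t − 1, for (i) take m = 2r + 3 and a + b = r + 1.
module Submission where

open import Defs
open import Data.Bool using (Bool; true; false; T; _∧_; _∨_)
open import Data.Bool.Properties using (T-≡; T-∧; T-∨)
open import Data.Empty using (⊥; ⊥-elim)
open import Data.Fin using (Fin; toℕ; fromℕ<)
open import Data.Fin.Properties using (toℕ-injective; toℕ-fromℕ<; toℕ<n)
open import Data.Fin.Subset using (Subset; ∣_∣; _∩_; _∈_; Nonempty)
open import Data.Fin.Subset.Properties using (nonempty?; x∈p∩q⁺; x∈p∩q⁻)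
open import Data.Nat
open import Data.Nat.DivMod using (%-distribˡ-+; m%n%n≡m%n; m≡m%n+[m/n]*n; [m+n]%n≡m%n; m<n⇒m%n≡m)
open import Data.Nat.Properties
open import Data.Nat.Tactic.RingSolver using (solve; solve-∀)
open import Data.List using (_∷_; [])
open import Data.Product using (Σ; _×_; _,_; proj₁; proj₂)
open import Data.Sum using (_⊎_; inj₁; inj₂)
open import Data.Vec using (tabulate)
open import Data.Vec.Properties using (lookup∘tabulate; []=⇒lookup; lookup⇒[]=)
open import Function using (_∘_; Equivalence)
open import Relation.Binary.PropositionalEquality
open import Relation.Nullary using (¬_; yes; no)

open Equivalence using (to; from)

count : (ℕ → Bool) → ℕ → ℕ
count g zero = 0
count g (suc n) with g 0
... | true  = suc (count (g ∘ suc) n)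
... | false = count (g ∘ suc) n

count-cong : ∀ {g h} n → (∀ {e} → e < n → g e ≡ h e) → count g n ≡ count h n
count-cong zero _ = refl
count-cong {g} {h} (suc n) g≗h with g 0 | h 0 | g≗h {0} z<s
... | true  | .true  | refl = cong suc (count-cong n (g≗h ∘ s<s))
... | false | .false | refl = count-cong n (g≗h ∘ s<s)

count-+ : ∀ g m n → count g (m + n) ≡ count g m + count (λ e → g (m + e)) n
count-+ g zero n = refl
count-+ g (suc m) n with g 0
... | true  = cong suc (count-+ (g ∘ suc) m n)
... | false = count-+ (g ∘ suc) m n

count-all : ∀ {g} n → (∀ {e} → e < n → T (g e)) → count g n ≡ n
count-all zero _ = refl
count-all {g} (suc n) all with g 0 | all {0} z<s
... | true  | _  = cong suc (count-all n (all ∘ s<s))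
... | false | ()

count-none : ∀ {g} n → (∀ {e} → e < n → ¬ T (g e)) → count g n ≡ 0
count-none zero _ = refl
count-none {g} (suc n) none with g 0 | none {0} z<s
... | false | _   = count-none n (none ∘ s<s)
... | true  | ¬tt = ⊥-elim (¬tt _)

count-∨ : ∀ {g h} n → (∀ {e} → e < n → T (g e) → T (h e) → ⊥) →
  count (λ e → g e ∨ h e) n ≡ count g n + count h n
count-∨ zero _ = refl
count-∨ {g} {h} (suc n) disjoint with g 0 | h 0 | disjoint {0} z<s
... | true  | true  | d = ⊥-elim (d _ _)
... | true  | false | _ = cong suc (count-∨ n (disjoint ∘ s<s))
... | false | true  | _ = trans (cong suc (count-∨ n (disjoint ∘ s<s))) (sym (+-suc _ _))
... | false | false | _ = count-∨ n (disjoint ∘ s<s)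

interval : ℕ → ℕ → ℕ → Bool
interval lo hi e = (lo ≤ᵇ e) ∧ (e <ᵇ hi)

interval⁺ : ∀ {lo hi e} → lo ≤ e → e < hi → T (interval lo hi e)
interval⁺ lo≤e e<hi = from T-∧ (≤⇒≤ᵇ lo≤e , <⇒<ᵇ e<hi)

interval⁻ : ∀ lo hi {e} → T (interval lo hi e) → lo ≤ e × e < hi
interval⁻ lo hi {e} h with to T-∧ h
... | lo≤ᵇe , e<ᵇhi = ≤ᵇ⇒≤ lo e lo≤ᵇe , <ᵇ⇒< e hi e<ᵇhi

count-interval : ∀ {lo hi n} → lo ≤ hi → hi ≤ n → count (interval lo hi) n ≡ hi ∸ lo
count-interval {lo} {hi} {n} lo≤hi hi≤n = begin
  count I n
    ≡⟨ cong (count I) (sym split) ⟩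
  count I (lo + (hi ∸ lo + (n ∸ hi)))
    ≡⟨ count-+ I lo _ ⟩
  count I lo + count (λ e → I (lo + e)) (hi ∸ lo + (n ∸ hi))
    ≡⟨ cong (count I lo +_) (count-+ _ (hi ∸ lo) _) ⟩
  count I lo + (count (λ e → I (lo + e)) (hi ∸ lo) + count (λ e → I (lo + (hi ∸ lo + e))) (n ∸ hi))
    ≡⟨ cong₂ _+_ below (cong₂ _+_ inside above) ⟩
  0 + (hi ∸ lo + 0)
    ≡⟨ +-identityʳ _ ⟩
  hi ∸ lo ∎
  where
  open ≡-Reasoning
  I = interval lo hi
  lo+[hi∸lo]≡hi = m+[n∸m]≡n lo≤hi
  split : lo + (hi ∸ lo + (n ∸ hi)) ≡ n
  split = trans (sym (+-assoc lo _ _)) (trans (cong (_+ (n ∸ hi)) lo+[hi∸lo]≡hi) (m+[n∸m]≡n hi≤n))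
  below = count-none lo (λ e<lo h → <⇒≱ e<lo (proj₁ (interval⁻ lo hi h)))
  inside = count-all (hi ∸ lo) λ {e} e<d →
    interval⁺ (m≤m+n lo e) (subst (lo + e <_) lo+[hi∸lo]≡hi (+-monoʳ-< lo e<d))
  above = count-none (n ∸ hi) λ {e} _ h → <⇒≱ (proj₂ (interval⁻ lo hi h))
    (subst (hi ≤_) (sym (trans (sym (+-assoc lo _ e)) (cong (_+ e) lo+[hi∸lo]≡hi))) (m≤m+n hi e))

offset⁺ : ∀ {s len u x} → s + u ≡ x → u < len → T (interval s (s + len) x)
offset⁺ {s} {u = u} refl u<len = interval⁺ (m≤m+n s u) (+-monoʳ-< s u<len)

offset⁻ : ∀ s len {x} → T (interval s (s + len) x) → Σ ℕ λ u → u < len × s + u ≡ x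
offset⁻ s len {x} h with interval⁻ s (s + len) h
... | s≤x , x<s+len = x ∸ s , +-cancelˡ-< s _ _ (subst (_< s + len) (sym s+u≡x) x<s+len) , s+u≡x
  where s+u≡x = m+[n∸m]≡n s≤x

-- The arc of the len residues s, s + 1, … modulo m, as points of [0, m); this is
-- the intended set only when s + len ≤ 2m.
arc : ℕ → ℕ → ℕ → ℕ → Bool
arc m s len e = (e <ᵇ m) ∧ (interval s (s + len) e ∨ interval s (s + len) (m + e))

arc⁺ : ∀ m s len {e u} → e < m → u < len → s + u ≡ e ⊎ s + u ≡ m + e → T (arc m s len e)
arc⁺ m s len e<m u<len (inj₁ eq) = from T-∧ (<⇒<ᵇ e<m , from T-∨ (inj₁ (offset⁺ eq u<len)))
arc⁺ m s len e<m u<len (inj₂ eq) = from T-∧ (<⇒<ᵇ e<m , from T-∨ (inj₂ (offset⁺ eq u<len)))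

arc⁻ : ∀ m s len {e} → T (arc m s len e) →
  e < m × Σ ℕ λ u → u < len × (s + u ≡ e ⊎ s + u ≡ m + e)
arc⁻ m s len {e} h with to T-∧ h
... | e<ᵇm , on with to T-∨ on
...   | inj₁ h₁ = let u , u<len , eq = offset⁻ s len h₁ in <ᵇ⇒< e m e<ᵇm , u , u<len , inj₁ eq
...   | inj₂ h₂ = let u , u<len , eq = offset⁻ s len h₂ in <ᵇ⇒< e m e<ᵇm , u , u<len , inj₂ eq

count-arc : ∀ {m s len n} → m ≤ n → len ≤ m → s + len ≤ m + m → count (arc m s len) n ≡ len
count-arc {m} {s} {len} {n} m≤n len≤m s+len≤2m = begin
  count A n
    ≡⟨ cong (count A) (sym (m+[n∸m]≡n m≤n)) ⟩
  count A (m + (n ∸ m))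
    ≡⟨ count-+ A m _ ⟩
  count A m + count (λ e → A (m + e)) (n ∸ m)
    ≡⟨ cong₂ _+_ on-cycle off-cycle ⟩
  count (λ e → I e ∨ I (m + e)) m + 0
    ≡⟨ +-identityʳ _ ⟩
  count (λ e → I e ∨ I (m + e)) m
    ≡⟨ count-∨ m disjoint ⟩
  count I m + count (λ e → I (m + e)) m
    ≡⟨ sym (count-+ I m m) ⟩
  count I (m + m)
    ≡⟨ count-interval (m≤m+n s len) s+len≤2m ⟩
  s + len ∸ s
    ≡⟨ m+n∸m≡n s len ⟩
  len ∎
  where
  open ≡-Reasoning
  A = arc m s len
  I = interval s (s + len)
  on-cycle = count-cong m λ {e} e<m → cong (_∧ (I e ∨ I (m + e))) (to T-≡ (<⇒<ᵇ e<m))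
  off-cycle = count-none (n ∸ m) λ {e} _ h → <⇒≱ (proj₁ (arc⁻ m s len h)) (m≤m+n m e)
  disjoint : ∀ {e} → e < m → T (I e) → T (I (m + e)) → ⊥
  disjoint {e} _ he hme = <⇒≱ (proj₂ (interval⁻ s (s + len) hme))
    (≤-trans (+-monoʳ-≤ s len≤m) (subst (s + m ≤_) (+-comm e m) (+-monoˡ-≤ m (proj₁ (interval⁻ s (s + len) he)))))

count-arc∨interval : ∀ {m s len lo hi n} → len ≤ m → s + len ≤ m + m → m ≤ lo → lo ≤ hi → hi ≤ n →
  count (λ e → arc m s len e ∨ interval lo hi e) n ≡ len + (hi ∸ lo)
count-arc∨interval {m} {s} {len} {lo} {hi} {n} len≤m s+len≤2m m≤lo lo≤hi hi≤n =
  trans (count-∨ n disjoint)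
        (cong₂ _+_ (count-arc (≤-trans (≤-trans m≤lo lo≤hi) hi≤n) len≤m s+len≤2m)
                   (count-interval lo≤hi hi≤n))
  where
  disjoint : ∀ {e} → e < n → T (arc m s len e) → T (interval lo hi e) → ⊥
  disjoint _ on-arc in-interval =
    <⇒≱ (proj₁ (arc⁻ m s len on-arc)) (≤-trans m≤lo (proj₁ (interval⁻ lo hi in-interval)))

module _ {m : ℕ} .{{_ : NonZero m}} where

  [x%m+y]%m≡[x+y]%m : ∀ x y → (x % m + y) % m ≡ (x + y) % m
  [x%m+y]%m≡[x+y]%m x y = begin
    (x % m + y) % m         ≡⟨ %-distribˡ-+ (x % m) y m ⟩
    (x % m % m + y % m) % m ≡⟨ cong (λ z → (z + y % m) % m) (m%n%n≡m%n x m) ⟩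
    (x % m + y % m) % m     ≡⟨ sym (%-distribˡ-+ x y m) ⟩
    (x + y) % m             ∎
    where open ≡-Reasoning

  multiple<m⇒≡0 : ∀ {x} q → x ≡ q * m → x < m → x ≡ 0
  multiple<m⇒≡0 zero    x≡0     _   = x≡0
  multiple<m⇒≡0 (suc q) x≡m+qm x<m = ⊥-elim (<⇒≱ x<m (subst (m ≤_) (sym x≡m+qm) (m≤m+n m _)))

  [i+x]%m≡i⇒x≡0 : ∀ {i x} → x < m → (i + x) % m ≡ i → x ≡ 0
  [i+x]%m≡i⇒x≡0 {i} {x} x<m [i+x]%m≡i = multiple<m⇒≡0 ((i + x) / m)
    (+-cancelˡ-≡ i x _ (trans (m≡m%n+[m/n]*n (i + x) m) (cong (_+ (i + x) / m * m) [i+x]%m≡i)))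
    x<m

  -- Going around the cycle by d and then by d' returns to i, so d + d' ≡ 0 (mod m).
  offsets-cancel : ∀ {i j d d'} → i < m → d + d' < m →
    (i + d) % m ≡ j → (j + d') % m ≡ i → i ≡ j
  offsets-cancel {i} {j} {d} {d'} i<m d+d'<m i+d≡j j+d'≡i = begin
    i           ≡⟨ sym (m<n⇒m%n≡m i<m) ⟩
    i % m       ≡⟨ cong (_% m) (sym (+-identityʳ i)) ⟩
    (i + 0) % m ≡⟨ cong (λ z → (i + z) % m) (sym d≡0) ⟩
    (i + d) % m ≡⟨ i+d≡j ⟩
    j           ∎
    where
    open ≡-Reasoning
    around : (i + (d + d')) % m ≡ i
    around = begin
      (i + (d + d')) % m     ≡⟨ cong (_% m) (sym (+-assoc i d d')) ⟩
      (i + d + d') % m       ≡⟨ sym ([x%m+y]%m≡[x+y]%m (i + d) d') ⟩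
      ((i + d) % m + d') % m ≡⟨ cong (λ z → (z + d') % m) i+d≡j ⟩
      (j + d') % m           ≡⟨ j+d'≡i ⟩
      i                      ∎
    d≡0 : d ≡ 0
    d≡0 = m+n≡0⇒m≡0 d ([i+x]%m≡i⇒x≡0 d+d'<m around)

  arc-residue : ∀ s len {e} → T (arc m s len e) → Σ ℕ λ u → u < len × (s + u) % m ≡ e
  arc-residue s len {e} h with arc⁻ m s len h
  ... | e<m , u , u<len , inj₁ s+u≡e =
    u , u<len , trans (cong (_% m) s+u≡e) (m<n⇒m%n≡m e<m)
  ... | e<m , u , u<len , inj₂ s+u≡m+e =
    u , u<len , trans (cong (_% m) (trans s+u≡m+e (+-comm m e))) (trans ([m+n]%n≡m%n e m) (m<n⇒m%n≡m e<m))

toSubset : ∀ {k} → (ℕ → Bool) → Subset k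
toSubset g = tabulate (g ∘ toℕ)

∣toSubset∣ : ∀ k g → ∣ toSubset {k} g ∣ ≡ count g k
∣toSubset∣ zero    g = refl
∣toSubset∣ (suc k) g with g 0
... | true  = cong suc (∣toSubset∣ k (g ∘ suc))
... | false = ∣toSubset∣ k (g ∘ suc)

∈toSubset⁺ : ∀ {k} g {x : Fin k} → T (g (toℕ x)) → x ∈ toSubset g
∈toSubset⁺ g {x} h = lookup⇒[]= x _ (trans (lookup∘tabulate _ x) (to T-≡ h))

∈toSubset⁻ : ∀ {k} g {x : Fin k} → x ∈ toSubset g → T (g (toℕ x))
∈toSubset⁻ g {x} x∈ = from T-≡ (trans (sym (lookup∘tabulate _ x)) ([]=⇒lookup x∈))

toSubset-meet⁺ : ∀ {k} g h {e} → e < k → T (g e) → T (h e) → Nonempty (toSubset {k} g ∩ toSubset h)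
toSubset-meet⁺ g h e<k ge he = fromℕ< e<k , x∈p∩q⁺ (∈toSubset⁺ g (at g ge) , ∈toSubset⁺ h (at h he))
  where
  at : ∀ f → T (f _) → T (f (toℕ (fromℕ< e<k)))
  at f = subst (T ∘ f) (sym (toℕ-fromℕ< e<k))

toSubset-meet⁻ : ∀ {k} g h → Nonempty (toSubset {k} g ∩ toSubset h) → Σ ℕ λ e → T (g e) × T (h e)
toSubset-meet⁻ g h (x , x∈) with x∈p∩q⁻ (toSubset g) (toSubset h) x∈
... | x∈g , x∈h = toℕ x , ∈toSubset⁻ g x∈g , ∈toSubset⁻ h x∈h

isolationSet-of-pairs : ∀ {k t s} (X Y : Fin s → TSub k t) →
  (∀ i → A1 (X i) (Y i)) →
  (∀ i j → A1 (X i) (Y j) → A1 (X j) (Y i) → i ≡ j) →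
  IsIsolationSet (λ i → X i , Y i)
isolationSet-of-pairs X Y diagonal no-crossing =
  diagonal , λ i j i≢j → rows-differ i≢j , cols-differ i≢j , one-side-empty i≢j
  where
  rows-differ : ∀ {i j} → i ≢ j → proj₁ (X i) ≢ proj₁ (X j)
  rows-differ {i} {j} i≢j Xi≡Xj = i≢j (no-crossing i j
    (subst (λ Z → Nonempty (Z ∩ proj₁ (Y j))) (sym Xi≡Xj) (diagonal j))
    (subst (λ Z → Nonempty (Z ∩ proj₁ (Y i))) Xi≡Xj (diagonal i)))
  cols-differ : ∀ {i j} → i ≢ j → proj₁ (Y i) ≢ proj₁ (Y j)
  cols-differ {i} {j} i≢j Yi≡Yj = i≢j (no-crossing i j
    (subst (λ Z → Nonempty (proj₁ (X i) ∩ Z)) Yi≡Yj (diagonal i))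
    (subst (λ Z → Nonempty (proj₁ (X j) ∩ Z)) (sym Yi≡Yj) (diagonal j)))
  one-side-empty : ∀ {i j} → i ≢ j → ¬ A1 (X i) (Y j) ⊎ ¬ A1 (X j) (Y i)
  one-side-empty {i} {j} i≢j with nonempty? (proj₁ (X i) ∩ proj₁ (Y j))
  ... | yes XiYj = inj₂ (i≢j ∘ no-crossing i j XiYj)
  ... | no ¬XiYj = inj₁ ¬XiYj

module ArcConstruction (k t m a b p q : ℕ) (short : (a + b) + (a + b) < m)
  (row-size : suc a + p ≡ t) (col-size : suc b + q ≡ t) (fits : m + p + q ≤ k) where

  instance
    m≢0 : NonZero m
    m≢0 = >-nonZero (≤-<-trans z≤n short)

  a+b<m : a + b < m
  a+b<m = ≤-<-trans (m≤m+n (a + b) (a + b)) short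

  a<m : a < m
  a<m = ≤-<-trans (m≤m+n a b) a+b<m

  b<m : b < m
  b<m = ≤-<-trans (m≤n+m b a) a+b<m

  m+p≤k : m + p ≤ k
  m+p≤k = ≤-trans (m≤m+n (m + p) q) fits

  m≤k : m ≤ k
  m≤k = ≤-trans (m≤m+n m p) m+p≤k

  in-row in-col : ℕ → ℕ → Bool
  in-row i e = arc m i (suc a) e ∨ interval m (m + p) e
  in-col j e = arc m (j + (m ∸ b)) (suc b) e ∨ interval (m + p) (m + p + q) e

  col-end : ∀ j → j + (m ∸ b) + b ≡ j + m
  col-end j = trans (+-assoc j _ b) (cong (j +_) (m∸n+n≡m (<⇒≤ b<m)))

  row-set : Fin m → TSub k t
  row-set i = toSubset (in-row (toℕ i)) , (begin
    ∣ toSubset {k} (in-row (toℕ i)) ∣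
      ≡⟨ ∣toSubset∣ k _ ⟩
    count (in-row (toℕ i)) k
      ≡⟨ count-arc∨interval a<m fits-cycle ≤-refl (m≤m+n m p) m+p≤k ⟩
    suc a + (m + p ∸ m)
      ≡⟨ cong (suc a +_) (m+n∸m≡n m p) ⟩
    suc a + p
      ≡⟨ row-size ⟩
    t ∎)
    where
    open ≡-Reasoning
    fits-cycle : toℕ i + suc a ≤ m + m
    fits-cycle = +-mono-≤ (<⇒≤ (toℕ<n i)) a<m

  col-set : Fin m → TSub k t
  col-set j = toSubset (in-col (toℕ j)) , (begin
    ∣ toSubset {k} (in-col (toℕ j)) ∣
      ≡⟨ ∣toSubset∣ k _ ⟩
    count (in-col (toℕ j)) k
      ≡⟨ count-arc∨interval b<m fits-cycle (m≤m+n m p) (m≤m+n (m + p) q) fits ⟩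
    suc b + (m + p + q ∸ (m + p))
      ≡⟨ cong (suc b +_) (m+n∸m≡n (m + p) q) ⟩
    suc b + q
      ≡⟨ col-size ⟩
    t ∎)
    where
    open ≡-Reasoning
    fits-cycle : toℕ j + (m ∸ b) + suc b ≤ m + m
    fits-cycle = subst (_≤ m + m) (sym (trans (+-suc _ b) (cong suc (col-end (toℕ j)))))
      (+-monoˡ-≤ m (toℕ<n j))

  diagonal : ∀ i → A1 (row-set i) (col-set i)
  diagonal i = toSubset-meet⁺ (in-row (toℕ i)) (in-col (toℕ i)) (<-≤-trans i<m m≤k) on-row on-col
    where
    i<m = toℕ<n i
    on-row : T (in-row (toℕ i) (toℕ i))
    on-row = from T-∨ (inj₁ (arc⁺ m (toℕ i) (suc a) i<m z<s (inj₁ (+-identityʳ (toℕ i)))))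
    on-col : T (in-col (toℕ i) (toℕ i))
    on-col = from T-∨ (inj₁ (arc⁺ m (toℕ i + (m ∸ b)) (suc b) i<m (n<1+n b)
      (inj₂ (trans (col-end (toℕ i)) (+-comm (toℕ i) m)))))

  meet-on-arcs : ∀ i j {e} → T (in-row i e) → T (in-col j e) →
    T (arc m i (suc a) e) × T (arc m (j + (m ∸ b)) (suc b) e)
  meet-on-arcs i j r c with to T-∨ r | to T-∨ c
  ... | inj₁ r′ | inj₁ c′ = r′ , c′
  ... | inj₁ r′ | inj₂ c′ = ⊥-elim (<⇒≱ (proj₁ (arc⁻ m i (suc a) r′))
                                          (≤-trans (m≤m+n m p) (proj₁ (interval⁻ (m + p) (m + p + q) c′))))
  ... | inj₂ r′ | inj₁ c′ = ⊥-elim (<⇒≱ (proj₁ (arc⁻ m (j + (m ∸ b)) (suc b) c′)) (proj₁ (interval⁻ m (m + p) r′)))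
  ... | inj₂ r′ | inj₂ c′ = ⊥-elim (<⇒≱ (proj₂ (interval⁻ m (m + p) r′)) (proj₁ (interval⁻ (m + p) (m + p + q) c′)))

  crossing-offset : ∀ i j {e} → j < m → T (in-row i e) → T (in-col j e) →
    Σ ℕ λ d → d ≤ a + b × (i + d) % m ≡ j
  crossing-offset i j j<m r c with meet-on-arcs i j r c
  ... | on-row , on-col with arc-residue {m} i (suc a) on-row | arc-residue {m} (j + (m ∸ b)) (suc b) on-col
  ... | u , u≤a , [i+u]%m≡e | v , v≤b , [s+v]%m≡e =
    u + (b ∸ v) , +-mono-≤ (s≤s⁻¹ u≤a) (m∸n≤m b v) , (begin
      (i + (u + (b ∸ v))) % m     ≡⟨ cong (_% m) (sym (+-assoc i u _)) ⟩
      (i + u + (b ∸ v)) % m       ≡⟨ sym ([x%m+y]%m≡[x+y]%m (i + u) _) ⟩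
      ((i + u) % m + (b ∸ v)) % m ≡⟨ cong (λ z → (z + (b ∸ v)) % m) (trans [i+u]%m≡e (sym [s+v]%m≡e)) ⟩
      ((s + v) % m + (b ∸ v)) % m ≡⟨ [x%m+y]%m≡[x+y]%m (s + v) _ ⟩
      (s + v + (b ∸ v)) % m       ≡⟨ cong (_% m) s+v+[b∸v]≡j+m ⟩
      (j + m) % m                 ≡⟨ [m+n]%n≡m%n j m ⟩
      j % m                       ≡⟨ m<n⇒m%n≡m j<m ⟩
      j                           ∎)
    where
    open ≡-Reasoning
    s = j + (m ∸ b)
    s+v+[b∸v]≡j+m : s + v + (b ∸ v) ≡ j + m
    s+v+[b∸v]≡j+m = trans (+-assoc s v _) (trans (cong (s +_) (m+[n∸m]≡n (s≤s⁻¹ v≤b))) (col-end j))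

  no-crossing : ∀ i j → A1 (row-set i) (col-set j) → A1 (row-set j) (col-set i) → i ≡ j
  no-crossing i j ij ji with toSubset-meet⁻ _ _ ij | toSubset-meet⁻ _ _ ji
  ... | e , r , c | e′ , r′ , c′
    with crossing-offset (toℕ i) (toℕ j) {e} (toℕ<n j) r c | crossing-offset (toℕ j) (toℕ i) {e′} (toℕ<n i) r′ c′
  ... | d , d≤a+b , i+d≡j | d′ , d′≤a+b , j+d′≡i =
    toℕ-injective (offsets-cancel (toℕ<n i) (≤-<-trans (+-mono-≤ d≤a+b d′≤a+b) short) i+d≡j j+d′≡i)

  isolationSet : HasIsolationSetOfSize k t m
  isolationSet = (λ i → row-set i , col-set i) , isolationSet-of-pairs row-set col-set diagonal no-crossing

isolationSet-of-size-k : ∀ t k → 4 * suc t ≤ k + 3 → HasIsolationSetOfSize k (suc t) k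
isolationSet-of-size-k t k 4[1+t]≤k+3 =
  ArcConstruction.isolationSet k (suc t) k t t 0 0 short (+-identityʳ _) (+-identityʳ _)
    (≤-reflexive (trans (+-identityʳ (k + 0)) (+-identityʳ k)))
  where
  short : t + t + (t + t) < k
  short = +-cancelˡ-≤ 3 _ _ (subst₂ _≤_ 4[1+t]≡3+[1+4t] (+-comm k 3) 4[1+t]≤k+3)
    where
    4[1+t]≡3+[1+4t] : 4 * suc t ≡ 3 + suc (t + t + (t + t))
    4[1+t]≡3+[1+4t] = solve (t ∷ [])

isolationSet-of-size-2r+3 : ∀ t r → r + 3 ≤ 2 * suc t →
  HasIsolationSetOfSize (2 * suc t + r) (suc t) (2 * r + 3)
isolationSet-of-size-2r+3 t r r+3≤2t+2 =
  ArcConstruction.isolationSet _ (suc t) _ a b (t ∸ a) (t ∸ b) short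
    (cong suc (m+[n∸m]≡n a≤t)) (cong suc (m+[n∸m]≡n b≤t)) (≤-reflexive fits)
  where
  open ≡-Reasoning
  -- Any a, b ≤ t with a + b = r + 1 will do.
  a = r + 1 ∸ t
  b = t ⊓ (r + 1)
  a+b≡r+1 : a + b ≡ r + 1
  a+b≡r+1 = trans (+-comm a b) (m⊓n+n∸m≡n t (r + 1))
  r+1≤t+t : r + 1 ≤ t + t
  r+1≤t+t = +-cancelˡ-≤ 2 _ _ (subst₂ _≤_ r+3≡2+[r+1] 2[1+t]≡2+[t+t] r+3≤2t+2)
    where
    r+3≡2+[r+1] : r + 3 ≡ 2 + (r + 1)
    r+3≡2+[r+1] = solve (r ∷ [])
    2[1+t]≡2+[t+t] : 2 * suc t ≡ 2 + (t + t)
    2[1+t]≡2+[t+t] = solve (t ∷ [])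
  a≤t : a ≤ t
  a≤t = subst (a ≤_) (m+n∸n≡m t t) (∸-monoˡ-≤ t r+1≤t+t)
  b≤t : b ≤ t
  b≤t = m⊓n≤m t (r + 1)
  short : a + b + (a + b) < 2 * r + 3
  short = subst (λ x → x + x < 2 * r + 3) (sym a+b≡r+1) (≤-reflexive 1+2[r+1]≡2r+3)
    where
    1+2[r+1]≡2r+3 : suc (r + 1 + (r + 1)) ≡ 2 * r + 3
    1+2[r+1]≡2r+3 = solve (r ∷ [])
  fits : 2 * r + 3 + (t ∸ a) + (t ∸ b) ≡ 2 * suc t + r
  fits = +-cancelʳ-≡ (a + b) _ _ (begin
    2 * r + 3 + (t ∸ a) + (t ∸ b) + (a + b)   ≡⟨ interchange (2 * r + 3) (t ∸ a) (t ∸ b) a b ⟩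
    2 * r + 3 + (a + (t ∸ a)) + (b + (t ∸ b)) ≡⟨ cong₂ (λ x y → 2 * r + 3 + x + y) (m+[n∸m]≡n a≤t) (m+[n∸m]≡n b≤t) ⟩
    2 * r + 3 + t + t                         ≡⟨ solve (r ∷ t ∷ []) ⟩
    2 * suc t + r + (r + 1)                   ≡⟨ cong (2 * suc t + r +_) (sym a+b≡r+1) ⟩
    2 * suc t + r + (a + b)                   ∎)
    where
    interchange : ∀ n x y a b → n + x + y + (a + b) ≡ n + (a + x) + (b + y)
    interchange = solve-∀

theorem3 : (t k : ℕ) → 2 ≤ t →
    ((r : ℕ) → k ≡ 2 * t + r → r + 3 ≤ 2 * t →
      HasIsolationSetOfSize k t (2 * r + 3))
    × (4 * t ≤ k + 3 → HasIsolationSetOfSize k t k)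
theorem3 zero    k ()
theorem3 (suc t) k _ =
  (λ r k≡2t+r r+3≤2t → subst (λ n → HasIsolationSetOfSize n (suc t) (2 * r + 3)) (sym k≡2t+r)
                          (isolationSet-of-size-2r+3 t r r+3≤2t))
  , isolationSet-of-size-k t k
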